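{- Let $n\ge 3$ and $\pi_1,\pi_2\in S_n$. Then $G_{\pi_1}$ and $G_{\pi_2}$ are isomorphic if, and only if, there is a clean isomorphism between $G^-_{\pi_1}$ and $G^-_{\pi_2}$.
   Context: $S_n$ is the symmetric group on $\{1,\dots,n\}$. Fix disjoint vertex sets $A=\{a_1,\dots,a_n\}$, $B=\{b_1,\dots,b_n\}$, $C=\{c_1,\dots,c_n\}$, $D=\{d_1,\dots,d_n\}$. For $\pi\in S_n$, $G^-_\pi$ is the graph on $A\cup B\cup C\cup D$ with edges $\{a_i,b_j\}$ ($i\ne j$), $\{b_i,c_i\}$ (all $i$), $\{c_i,d_j\}$ ($i\ne j$), and $\{a_i,d_{\pi(i)}\}$ (all $i$). $G_\pi$ is obtained from $G^-_\pi$ by adding three new vertices $e,f,g$ with neighbourhoods $N(e)=B\cup D\cup\{f,g\}$, $N(f)=A\cup C\cup\{e\}$, $N(g)=C\cup\{e\}$. A map $\alpha$ from $A\cup B\cup C\cup D$ to itself is clean if $\alpha(A)=A$, $\alpha(B)=B$, $\alpha(C)=C$ and $\alpha(D)=D$. -}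

module Defs where

open import Data.Nat using (ℕ)
open import Data.Fin using (Fin)
open import Data.Fin.Permutation using (Permutation′; _⟨$⟩ʳ_)
open import Data.Product using (Σ; _×_; _,_; proj₁)
open import Data.Sum using (_⊎_; inj₁; inj₂)
open import Data.Empty using (⊥)
open import Data.Unit using (⊤)
open import Relation.Nullary using (¬_)
open import Relation.Binary.PropositionalEquality using (_≡_)
open import Function.Bundles using (_↔_; Inverse; _⇔_)

data Part : Set where
  A B C D : Part

-- Vertex x_i of G⁻_π is (x , i) with x ∈ {A,B,C,D}, i ∈ Fin n.
V⁻ : ℕ → Set
V⁻ n = Part × Fin n

Edge⁻ : ∀ {n} → Permutation′ n → V⁻ n → V⁻ n → Set
Edge⁻ π (A , i) (B , j) = ¬ (i ≡ j)
Edge⁻ π (B , i) (C , j) = i ≡ j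
Edge⁻ π (C , i) (D , j) = ¬ (i ≡ j)
Edge⁻ π (A , i) (D , j) = π ⟨$⟩ʳ i ≡ j
Edge⁻ π _ _ = ⊥

Adj⁻ : ∀ {n} → Permutation′ n → V⁻ n → V⁻ n → Set
Adj⁻ π u v = Edge⁻ π u v ⊎ Edge⁻ π v u

data V {n : ℕ} : Set where
  old : V⁻ n → V
  e f g : V

Edge : ∀ {n} → Permutation′ n → V {n} → V {n} → Set
Edge π (old u) (old v) = Edge⁻ π u v
Edge π e (old (B , _)) = ⊤
Edge π e (old (D , _)) = ⊤
Edge π e f = ⊤
Edge π e g = ⊤
Edge π f (old (A , _)) = ⊤
Edge π f (old (C , _)) = ⊤
Edge π g (old (C , _)) = ⊤
Edge π _ _ = ⊥

Adj : ∀ {n} → Permutation′ n → V {n} → V {n} → Set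
Adj π u v = Edge π u v ⊎ Edge π v u

IsIso : {X Y : Set} → (X → X → Set) → (Y → Y → Set) → (X ↔ Y) → Set
IsIso R S φ = ∀ u v → R u v ⇔ S (Inverse.to φ u) (Inverse.to φ v)

Isomorphic : {X Y : Set} → (X → X → Set) → (Y → Y → Set) → Set
Isomorphic {X} {Y} R S = Σ (X ↔ Y) (IsIso R S)

-- α is clean if α(A)=A, α(B)=B, α(C)=C, α(D)=D, i.e. it preserves the part
-- of every vertex (for a bijection this is equivalent to the set equalities).
IsClean : ∀ {n} → (V⁻ n → V⁻ n) → Set
IsClean α = ∀ x i → proj₁ (α (x , i)) ≡ x

{-# OPTIONS --safe #-}
module Submission where

-- Degrees single out e (degree 2n + 2), f (2n + 1) and the c_i (n + 2; all other vertices have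
-- degree n + 1), so an isomorphism G_π₁ ≅ G_π₂ fixes e and f and maps C to C.  The image of g is
-- a neighbour of e all of whose neighbours lie in {e} ∪ C; since every b_j and d_j has a
-- neighbour in A, g is fixed.  Each d_i has two C-neighbours (here n ≥ 3 is used) whereas b_j has
-- only one, so the remaining neighbours of e split as D ↦ D, B ↦ B; applying all this to the
-- inverse as well, the neighbours of f give A ↦ A.  Restricting to the old vertices gives a clean
-- isomorphism.  Conversely, adjacency between an added vertex and a_i, b_i, c_i, d_i depends only
-- on the part, so a clean isomorphism of G⁻ extends by fixing e, f and g.

open import Defs
open import Data.Nat using (ℕ; suc; _+_; _≥_; _≤_; _<_; s≤s; s≤s⁻¹)
open import Data.Nat.Properties using (n≮n; m+n≮m; m+1+n≰m; m≤n+m; <⇒≱)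
open import Data.Fin using (Fin; punchIn; punchOut)
open import Data.Fin.Patterns using (0F; 1F)
open import Data.Fin.Properties
  using (injective⇒≤; punchIn-injective; punchInᵢ≢i; punchIn-punchOut)
open import Data.Fin.Permutation using (Permutation′; _⟨$⟩ʳ_; _⟨$⟩ˡ_)
import Data.Fin.Permutation as Permutation
open import Data.Product using (Σ; ∃; _×_; _,_; proj₁; proj₂)
open import Data.Sum using (_⊎_; inj₁; inj₂; swap)
open import Data.Unit using (tt)
open import Data.Vec using (Vec; _∷_; _++_; tabulate; lookup)
open import Data.Vec.Relation.Unary.All using (All; _∷_)
import Data.Vec.Relation.Unary.All as All
open import Data.Vec.Relation.Unary.All.Properties
  using (lookup⁺; tabulate⁺) renaming (++⁺ to All-++⁺)
import Data.Vec.Relation.Unary.Any as Any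
open import Data.Vec.Relation.Unary.Any.Properties using (lookup-index)
open import Data.Vec.Relation.Unary.AllPairs using ([]; _∷_)
open import Data.Vec.Relation.Unary.Unique.Propositional using (Unique)
open import Data.Vec.Relation.Unary.Unique.Propositional.Properties
  using (lookup-injective) renaming (tabulate⁺ to Unique-tabulate⁺)
open import Data.Vec.Membership.Propositional using (_∈_)
open import Data.Vec.Membership.Propositional.Properties using (∈-tabulate⁺; ∈-++⁺ˡ; ∈-++⁺ʳ)
open import Data.Vec.Relation.Unary.Any using (here; there)
open import Function using (_∘_; id)
open import Function.Bundles
  using (_⇔_; _↔_; Inverse; Equivalence; Injection; mk⇔; mk↔ₛ′)
open import Function.Construct.Identity using (⇔-id)
open import Function.Definitions using (Injective)
open import Function.Properties.Inverse using (↔-sym; ↔⇒↣)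
open import Relation.Nullary using (contradiction)
open import Relation.Binary.PropositionalEquality
  using (_≡_; _≢_; refl; sym; trans; cong; subst; subst₂; module ≡-Reasoning)

unique-injective⇒≤ : ∀ {X Y : Set} {h : X → Y} {k d} {xs : Vec X k} {ys : Vec Y d} →
                     Injective _≡_ _≡_ h → Unique xs → All (λ x → h x ∈ ys) xs → k ≤ d
unique-injective⇒≤ {h = h} {k} {d} {xs} {ys} h-injective xs-unique hxs∈ys =
  injective⇒≤ position-injective
  where
  position : Fin k → Fin d
  position i = Any.index (lookup⁺ hxs∈ys i)

  position-injective : Injective _≡_ _≡_ position
  position-injective {i} {j} eq = lookup-injective xs-unique i j (h-injective (begin
    h (lookup xs i)         ≡⟨ lookup-index (lookup⁺ hxs∈ys i) ⟩
    lookup ys (position i)  ≡⟨ cong (lookup ys) eq ⟩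
    lookup ys (position j)  ≡⟨ lookup-index (lookup⁺ hxs∈ys j) ⟨
    h (lookup xs j)         ∎))
    where open ≡-Reasoning

Unique-++⁺ : ∀ {X : Set} {k d} {xs : Vec X k} {ys : Vec X d} →
             Unique xs → Unique ys → All (λ x → All (x ≢_) ys) xs → Unique (xs ++ ys)
Unique-++⁺ []                  ys-unique _                 = ys-unique
Unique-++⁺ (x∉xs ∷ xs-unique) ys-unique (x∉ys ∷ disjoint) =
  All-++⁺ x∉xs x∉ys ∷ Unique-++⁺ xs-unique ys-unique disjoint

∈-tabulate-punchIn : ∀ {X : Set} {m} (h : Fin (suc m) → X) {i j} → i ≢ j →
                     h j ∈ tabulate (h ∘ punchIn i)
∈-tabulate-punchIn h i≢j =
  subst (λ l → h l ∈ _) (punchIn-punchOut i≢j) (∈-tabulate⁺ (h ∘ punchIn _) (punchOut i≢j))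

module Isomorphism {X Y : Set} (R : X → X → Set) (S : Y → Y → Set) (ψ : X ↔ Y)
                   (iso : IsIso R S ψ) where
  open Inverse ψ

  IsIso-sym : IsIso S R (↔-sym ψ)
  IsIso-sym u v = mk⇔
    (λ s → Equivalence.from (iso (from u) (from v))
             (subst₂ S (sym (strictlyInverseˡ u)) (sym (strictlyInverseˡ v)) s))
    (λ r → subst₂ S (strictlyInverseˡ u) (strictlyInverseˡ v)
             (Equivalence.to (iso (from u) (from v)) r))

  reflect-to : ∀ {u v} → S (to u) v → R u (from v)
  reflect-to {u} {v} s =
    Equivalence.from (iso u (from v)) (subst (S (to u)) (sym (strictlyInverseˡ v)) s)

  neighbour-count-≤ : ∀ {u k d} {xs : Vec X k} {ys : Vec Y d} →
                 Unique xs → All (R u) xs → (∀ {v} → S (to u) v → v ∈ ys) → k ≤ d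
  neighbour-count-≤ xs-unique adjacent complete =
    unique-injective⇒≤ (Injection.injective (↔⇒↣ ψ)) xs-unique
      (All.map (complete ∘ Equivalence.to (iso _ _)) adjacent)

module Restriction {X Y : Set} {ι : X → Y} (ι-injective : Injective _≡_ _≡_ ι) (ψ : Y ↔ Y)
                   (to-ι : ∀ x → ∃ λ x′ → Inverse.to ψ (ι x) ≡ ι x′)
                   (from-ι : ∀ x → ∃ λ x′ → Inverse.from ψ (ι x) ≡ ι x′) where
  open Inverse ψ

  restriction : X ↔ X
  restriction = mk↔ₛ′ (proj₁ ∘ to-ι) (proj₁ ∘ from-ι) inverse-to-from inverse-from-to
    where
    inverse-to-from : ∀ x → proj₁ (to-ι (proj₁ (from-ι x))) ≡ x
    inverse-to-from x = ι-injective (begin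
      ι (proj₁ (to-ι (proj₁ (from-ι x))))  ≡⟨ proj₂ (to-ι _) ⟨
      to (ι (proj₁ (from-ι x)))            ≡⟨ cong to (proj₂ (from-ι x)) ⟨
      to (from (ι x))                      ≡⟨ strictlyInverseˡ (ι x) ⟩
      ι x                                  ∎)
      where open ≡-Reasoning

    inverse-from-to : ∀ x → proj₁ (from-ι (proj₁ (to-ι x))) ≡ x
    inverse-from-to x = ι-injective (begin
      ι (proj₁ (from-ι (proj₁ (to-ι x))))  ≡⟨ proj₂ (from-ι _) ⟨
      from (ι (proj₁ (to-ι x)))            ≡⟨ cong from (proj₂ (to-ι x)) ⟨
      from (to (ι x))                      ≡⟨ strictlyInverseʳ (ι x) ⟩
      ι x                                  ∎)
      where open ≡-Reasoning

  restriction-IsIso : ∀ (R S : Y → Y → Set) → IsIso R S ψ →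
                      IsIso (λ u v → R (ι u) (ι v)) (λ u v → S (ι u) (ι v)) restriction
  restriction-IsIso R S iso u v =
    subst₂ (λ u′ v′ → R (ι u) (ι v) ⇔ S u′ v′) (proj₂ (to-ι u)) (proj₂ (to-ι v))
      (iso (ι u) (ι v))

pattern a i = old (A , i)
pattern b i = old (B , i)
pattern c i = old (C , i)
pattern d i = old (D , i)

InPart : ∀ {n} → Part → V {n} → Set
InPart x w = ∃ λ j → w ≡ old (x , j)

old-injective : ∀ {n} → Injective _≡_ _≡_ (old {n})
old-injective refl = refl

module _ {n} {π : Permutation′ n} where

  Adj-e : ∀ {w} → Adj π e w → w ≡ f ⊎ w ≡ g ⊎ InPart B w ⊎ InPart D w
  Adj-e {f}   (inj₁ _) = inj₁ refl
  Adj-e {g}   (inj₁ _) = inj₂ (inj₁ refl)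
  Adj-e {b j} (inj₁ _) = inj₂ (inj₂ (inj₁ (j , refl)))
  Adj-e {d j} (inj₁ _) = inj₂ (inj₂ (inj₂ (j , refl)))
  Adj-e {old _} (inj₂ ())

  Adj-f : ∀ {w} → Adj π f w → w ≡ e ⊎ InPart A w ⊎ InPart C w
  Adj-f {e}   (inj₂ _) = inj₁ refl
  Adj-f {a j} (inj₁ _) = inj₂ (inj₁ (j , refl))
  Adj-f {c j} (inj₁ _) = inj₂ (inj₂ (j , refl))

  Adj-g : ∀ {w} → Adj π g w → w ≡ e ⊎ InPart C w
  Adj-g {e}   (inj₂ _) = inj₁ refl
  Adj-g {c j} (inj₁ _) = inj₂ (j , refl)

  Adj-b-c : ∀ {i j} → Adj π (b i) (c j) → i ≡ j
  Adj-b-c (inj₁ i≡j) = i≡j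

module _ {n : ℕ} where

  lift : (V⁻ n → V⁻ n) → V {n} → V {n}
  lift α (old u) = old (α u)
  lift α e       = e
  lift α f       = f
  lift α g       = g

  lift-inverse : ∀ {α β} → (∀ u → α (β u) ≡ u) → ∀ w → lift α (lift β w) ≡ w
  lift-inverse αβ≗id (old u) = cong old (αβ≗id u)
  lift-inverse αβ≗id e       = refl
  lift-inverse αβ≗id f       = refl
  lift-inverse αβ≗id g       = refl

  extension : V⁻ n ↔ V⁻ n → V {n} ↔ V {n}
  extension φ =
    mk↔ₛ′ (lift to) (lift from) (lift-inverse strictlyInverseˡ) (lift-inverse strictlyInverseʳ)
    where open Inverse φ

data Added : Set where
  e f g : Added

added : ∀ {n} → Added → V {n}
added e = e
added f = f
added g = g

Adj-added-old : ∀ {n} {π π′ : Permutation′ n} (w : Added) {u u′ : V⁻ n} →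
                proj₁ u ≡ proj₁ u′ → Adj π (added w) (old u) ⇔ Adj π′ (added w) (old u′)
Adj-added-old e {A , _} refl = ⇔-id _
Adj-added-old e {B , _} refl = ⇔-id _
Adj-added-old e {C , _} refl = ⇔-id _
Adj-added-old e {D , _} refl = ⇔-id _
Adj-added-old f {A , _} refl = ⇔-id _
Adj-added-old f {B , _} refl = ⇔-id _
Adj-added-old f {C , _} refl = ⇔-id _
Adj-added-old f {D , _} refl = ⇔-id _
Adj-added-old g {A , _} refl = ⇔-id _
Adj-added-old g {B , _} refl = ⇔-id _
Adj-added-old g {C , _} refl = ⇔-id _
Adj-added-old g {D , _} refl = ⇔-id _

module _ {n} {π₁ π₂ : Permutation′ n} (φ : V⁻ n ↔ V⁻ n)
         (iso : IsIso (Adj⁻ π₁) (Adj⁻ π₂) φ) (clean : IsClean (Inverse.to φ)) where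
  open Inverse φ

  private
    added-old : ∀ w u → Adj π₁ (added w) (old u) ⇔ Adj π₂ (added w) (old (to u))
    added-old w (x , i) = Adj-added-old w (sym (clean x i))

    old-added : ∀ w u → Adj π₁ (old u) (added w) ⇔ Adj π₂ (old (to u)) (added w)
    old-added w u = mk⇔ (swap ∘ Equivalence.to (added-old w u) ∘ swap)
                        (swap ∘ Equivalence.from (added-old w u) ∘ swap)

  extension-IsIso : IsIso (Adj π₁) (Adj π₂) (extension φ)
  extension-IsIso (old u) (old v) = iso u v
  extension-IsIso (old u) e       = old-added e u
  extension-IsIso (old u) f       = old-added f u
  extension-IsIso (old u) g       = old-added g u
  extension-IsIso e (old u)       = added-old e u
  extension-IsIso f (old u)       = added-old f u
  extension-IsIso g (old u)       = added-old g u
  extension-IsIso e e             = ⇔-id _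
  extension-IsIso e f             = ⇔-id _
  extension-IsIso e g             = ⇔-id _
  extension-IsIso f e             = ⇔-id _
  extension-IsIso f f             = ⇔-id _
  extension-IsIso f g             = ⇔-id _
  extension-IsIso g e             = ⇔-id _
  extension-IsIso g f             = ⇔-id _
  extension-IsIso g g             = ⇔-id _

module _ {k : ℕ} where
  private
    n : ℕ
    n = 3 + k

  degree : V {n} → ℕ
  degree e     = 2 + (n + n)
  degree f     = 1 + (n + n)
  degree (c _) = 2 + n
  degree _     = 1 + n

  neighbours : Permutation′ n → (w : V {n}) → Vec (V {n}) (degree w)
  neighbours π (a i) = f ∷ d (π ⟨$⟩ʳ i) ∷ tabulate (λ l → b (punchIn i l))
  neighbours π (b i) = e ∷ c i ∷ tabulate (λ l → a (punchIn i l))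
  neighbours π (c i) = f ∷ g ∷ b i ∷ tabulate (λ l → d (punchIn i l))
  neighbours π (d i) = e ∷ a (π ⟨$⟩ˡ i) ∷ tabulate (λ l → c (punchIn i l))
  neighbours π e     = f ∷ g ∷ tabulate b ++ tabulate d
  neighbours π f     = e ∷ tabulate a ++ tabulate c
  neighbours π g     = e ∷ tabulate c

  Edge⇒∈neighbours : ∀ {π u v} → Edge π u v → v ∈ neighbours π u × u ∈ neighbours π v
  Edge⇒∈neighbours {_} {a i} {b j} i≢j  = there (there (∈-tabulate-punchIn b i≢j))
                                        , there (there (∈-tabulate-punchIn a (i≢j ∘ sym)))
  Edge⇒∈neighbours {_} {b i} {c i} refl = there (here refl) , there (there (here refl))
  Edge⇒∈neighbours {_} {c i} {d j} i≢j  = there (there (there (∈-tabulate-punchIn d i≢j)))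
                                        , there (there (∈-tabulate-punchIn c (i≢j ∘ sym)))
  Edge⇒∈neighbours {π} {a i} {d _} refl = there (here refl)
                                        , there (here (cong a (sym (Permutation.inverseˡ π))))
  Edge⇒∈neighbours {_} {e} {b j} _ = there (there (∈-++⁺ˡ (∈-tabulate⁺ b j))) , here refl
  Edge⇒∈neighbours {_} {e} {d j} _ = there (there (∈-++⁺ʳ (tabulate b) (∈-tabulate⁺ d j))) , here refl
  Edge⇒∈neighbours {_} {e} {f}   _ = here refl , here refl
  Edge⇒∈neighbours {_} {e} {g}   _ = there (here refl) , here refl
  Edge⇒∈neighbours {_} {f} {a j} _ = there (∈-++⁺ˡ (∈-tabulate⁺ a j)) , here refl
  Edge⇒∈neighbours {_} {f} {c j} _ = there (∈-++⁺ʳ (tabulate a) (∈-tabulate⁺ c j)) , here refl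
  Edge⇒∈neighbours {_} {g} {c j} _ = there (∈-tabulate⁺ c j) , there (here refl)

  Adj⇒∈neighbours : ∀ {π u v} → Adj π u v → v ∈ neighbours π u
  Adj⇒∈neighbours (inj₁ uv) = proj₁ (Edge⇒∈neighbours uv)
  Adj⇒∈neighbours (inj₂ vu) = proj₂ (Edge⇒∈neighbours vu)

  -- A vector tabulated over Fin (3 + k) unfolds by definition, so the function behind it
  -- cannot be recovered by unification; these two lemmas take it explicitly.
  All-tabulate : ∀ {m} {P : V {n} → Set} x (h : Fin m → Fin n) →
                 (∀ l → P (old (x , h l))) → All P (tabulate (λ l → old (x , h l)))
  All-tabulate x h = tabulate⁺

  tabulate-unique : ∀ {m} x (h : Fin m → Fin n) → Injective _≡_ _≡_ h →
                    Unique (tabulate (λ l → old (x , h l)))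
  tabulate-unique x h h-injective = Unique-tabulate⁺ (h-injective ∘ cong proj₂ ∘ old-injective)

  neighbours-Adj : ∀ π w → All (Adj π w) (neighbours π w)
  neighbours-Adj π (a i) = inj₂ tt ∷ inj₁ refl
                         ∷ All-tabulate B (punchIn i) (λ l → inj₁ (punchInᵢ≢i i l ∘ sym))
  neighbours-Adj π (b i) = inj₂ tt ∷ inj₁ refl
                         ∷ All-tabulate A (punchIn i) (λ l → inj₂ (punchInᵢ≢i i l))
  neighbours-Adj π (c i) = inj₂ tt ∷ inj₂ tt ∷ inj₂ refl
                         ∷ All-tabulate D (punchIn i) (λ l → inj₁ (punchInᵢ≢i i l ∘ sym))
  neighbours-Adj π (d i) = inj₂ tt ∷ inj₂ (Permutation.inverseʳ π)
                         ∷ All-tabulate C (punchIn i) (λ l → inj₂ (punchInᵢ≢i i l))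
  neighbours-Adj π e     = inj₁ tt ∷ inj₁ tt
                         ∷ All-++⁺ (All-tabulate B id λ _ → inj₁ tt) (All-tabulate D id λ _ → inj₁ tt)
  neighbours-Adj π f     = inj₂ tt
                         ∷ All-++⁺ (All-tabulate A id λ _ → inj₁ tt) (All-tabulate C id λ _ → inj₁ tt)
  neighbours-Adj π g     = inj₂ tt ∷ All-tabulate C id λ _ → inj₁ tt

  neighbours-unique : ∀ π w → Unique (neighbours π w)
  neighbours-unique π (a i) = ((λ ()) ∷ All-tabulate B (punchIn i) (λ _ ()))
                            ∷ All-tabulate B (punchIn i) (λ _ ())
                            ∷ tabulate-unique B (punchIn i) (punchIn-injective i _ _)
  neighbours-unique π (b i) = ((λ ()) ∷ All-tabulate A (punchIn i) (λ _ ()))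
                            ∷ All-tabulate A (punchIn i) (λ _ ())
                            ∷ tabulate-unique A (punchIn i) (punchIn-injective i _ _)
  neighbours-unique π (c i) = ((λ ()) ∷ (λ ()) ∷ All-tabulate D (punchIn i) (λ _ ()))
                            ∷ ((λ ()) ∷ All-tabulate D (punchIn i) (λ _ ()))
                            ∷ All-tabulate D (punchIn i) (λ _ ())
                            ∷ tabulate-unique D (punchIn i) (punchIn-injective i _ _)
  neighbours-unique π (d i) = ((λ ()) ∷ All-tabulate C (punchIn i) (λ _ ()))
                            ∷ All-tabulate C (punchIn i) (λ _ ())
                            ∷ tabulate-unique C (punchIn i) (punchIn-injective i _ _)
  neighbours-unique π e     = ((λ ()) ∷ All-++⁺ (All-tabulate B id λ _ ()) (All-tabulate D id λ _ ()))
                            ∷ All-++⁺ (All-tabulate B id λ _ ()) (All-tabulate D id λ _ ())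
                            ∷ Unique-++⁺ (tabulate-unique B id id) (tabulate-unique D id id)
                                         (All-tabulate B id λ _ → All-tabulate D id λ _ ())
  neighbours-unique π f     = All-++⁺ (All-tabulate A id λ _ ()) (All-tabulate C id λ _ ())
                            ∷ Unique-++⁺ (tabulate-unique A id id) (tabulate-unique C id id)
                                         (All-tabulate A id λ _ → All-tabulate C id λ _ ())
  neighbours-unique π g     = All-tabulate C id (λ _ ()) ∷ tabulate-unique C id id

  private
    2+n<1+n+n : 2 + n < 1 + (n + n)
    2+n<1+n+n = s≤s (s≤s (s≤s (m≤n+m n (suc k))))

  degree-≥⇒e : ∀ w → 2 + (n + n) ≤ degree w → w ≡ e
  degree-≥⇒e e     _ = refl
  degree-≥⇒e f     p = contradiction p (n≮n _)
  degree-≥⇒e (c _) p = contradiction (s≤s⁻¹ (s≤s⁻¹ p)) (m+1+n≰m n)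
  degree-≥⇒e (a _) p = contradiction (s≤s⁻¹ p) (m+n≮m n n)
  degree-≥⇒e (b _) p = contradiction (s≤s⁻¹ p) (m+n≮m n n)
  degree-≥⇒e (d _) p = contradiction (s≤s⁻¹ p) (m+n≮m n n)
  degree-≥⇒e g     p = contradiction (s≤s⁻¹ p) (m+n≮m n n)

  degree-≥⇒e⊎f : ∀ w → 1 + (n + n) ≤ degree w → w ≡ e ⊎ w ≡ f
  degree-≥⇒e⊎f e     _ = inj₁ refl
  degree-≥⇒e⊎f f     _ = inj₂ refl
  degree-≥⇒e⊎f (c _) p = contradiction p (<⇒≱ 2+n<1+n+n)
  degree-≥⇒e⊎f (a _) p = contradiction (s≤s⁻¹ p) (m+1+n≰m n)
  degree-≥⇒e⊎f (b _) p = contradiction (s≤s⁻¹ p) (m+1+n≰m n)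
  degree-≥⇒e⊎f (d _) p = contradiction (s≤s⁻¹ p) (m+1+n≰m n)
  degree-≥⇒e⊎f g     p = contradiction (s≤s⁻¹ p) (m+1+n≰m n)

  degree-≥⇒e⊎f⊎C : ∀ w → 2 + n ≤ degree w → w ≡ e ⊎ w ≡ f ⊎ InPart C w
  degree-≥⇒e⊎f⊎C e     _ = inj₁ refl
  degree-≥⇒e⊎f⊎C f     _ = inj₂ (inj₁ refl)
  degree-≥⇒e⊎f⊎C (c j) _ = inj₂ (inj₂ (j , refl))
  degree-≥⇒e⊎f⊎C (a _) p = contradiction p (n≮n _)
  degree-≥⇒e⊎f⊎C (b _) p = contradiction p (n≮n _)
  degree-≥⇒e⊎f⊎C (d _) p = contradiction p (n≮n _)
  degree-≥⇒e⊎f⊎C g     p = contradiction p (n≮n _)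

  B⊎D⇒A-neighbour : ∀ {π : Permutation′ n} {w : V {n}} →
                    InPart B w ⊎ InPart D w → ∃ λ l → Adj π w (a l)
  B⊎D⇒A-neighbour     (inj₁ (j , refl)) = punchIn j 0F , inj₂ (punchInᵢ≢i j 0F)
  B⊎D⇒A-neighbour {π} (inj₂ (j , refl)) = π ⟨$⟩ˡ j , inj₂ (Permutation.inverseʳ π)

  module Rigidity {π₁ π₂ : Permutation′ n} (ψ : V ↔ V) (iso : IsIso (Adj π₁) (Adj π₂) ψ) where
    open Inverse ψ
    open Isomorphism (Adj π₁) (Adj π₂) ψ iso using (reflect-to; neighbour-count-≤)

    private
      preserve : ∀ {u v} → Adj π₁ u v → Adj π₂ (to u) (to v)
      preserve = Equivalence.to (iso _ _)

      preserve-at : ∀ {u v} → to u ≡ u → Adj π₁ u v → Adj π₂ u (to v)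
      preserve-at {v = v} u↦u adj = subst (λ w → Adj π₂ w (to v)) u↦u (preserve adj)

      clash : ∀ {u v w} → to u ≡ w → to v ≡ w → u ≡ v
      clash u↦w v↦w = Injection.injective (↔⇒↣ ψ) (trans u↦w (sym v↦w))

      degree-≤ : ∀ w → degree w ≤ degree (to w)
      degree-≤ w = neighbour-count-≤ (neighbours-unique π₁ w) (neighbours-Adj π₁ w) Adj⇒∈neighbours

    fixes-e : to e ≡ e
    fixes-e = degree-≥⇒e (to e) (degree-≤ e)

    fixes-f : to f ≡ f
    fixes-f with degree-≥⇒e⊎f (to f) (degree-≤ f)
    ... | inj₁ f↦e = contradiction (clash f↦e fixes-e) λ ()
    ... | inj₂ f↦f = f↦f

    preserves-C : ∀ i → InPart C (to (c i))
    preserves-C i with degree-≥⇒e⊎f⊎C (to (c i)) (degree-≤ (c i))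
    ... | inj₁ c↦e        = contradiction (clash c↦e fixes-e) λ ()
    ... | inj₂ (inj₁ c↦f) = contradiction (clash c↦f fixes-f) λ ()
    ... | inj₂ (inj₂ c↦C) = c↦C

    Adj-to-g : ∀ {v} → Adj π₂ (to g) v → v ≡ e ⊎ InPart C v
    Adj-to-g adj with Adj-g (reflect-to adj)
    ... | inj₁ v↤e       = inj₁ (trans (sym (inverseˡ (sym v↤e))) fixes-e)
    ... | inj₂ (j , v↤c) = inj₂ (subst (InPart C) (inverseˡ (sym v↤c)) (preserves-C j))

    fixes-g : to g ≡ g
    fixes-g with Adj-e (preserve-at {v = g} fixes-e (inj₁ tt))
    ... | inj₁ g↦f              = contradiction (clash g↦f fixes-f) λ ()
    ... | inj₂ (inj₁ g↦g)       = g↦g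
    ... | inj₂ (inj₂ g↦B⊎D) with B⊎D⇒A-neighbour {π₂} g↦B⊎D
    ...   | l , adj with Adj-to-g adj
    ...     | inj₁ ()
    ...     | inj₂ (_ , ())

    D↛B : ∀ i j → to (d i) ≢ b j
    D↛B i j d↦b = contradiction (punchIn-injective i 0F 1F c-collision) λ ()
      where
      C-neighbour↦c : ∀ l → to (c (punchIn i l)) ≡ c j
      C-neighbour↦c l with preserves-C (punchIn i l)
      ... | j′ , c↦c = trans c↦c (cong c (sym (Adj-b-c {π = π₂} b~c)))
        where
        b~c : Adj π₂ (b j) (c j′)
        b~c = subst₂ (Adj π₂) d↦b c↦c (preserve {d i} {c (punchIn i l)} (inj₂ (punchInᵢ≢i i l)))

      c-collision : punchIn i 0F ≡ punchIn i 1F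
      c-collision = cong proj₂ (old-injective (clash (C-neighbour↦c 0F) (C-neighbour↦c 1F)))

    preserves-D : ∀ i → InPart D (to (d i))
    preserves-D i with Adj-e (preserve-at {v = d i} fixes-e (inj₁ tt))
    ... | inj₁ d↦f                     = contradiction (clash d↦f fixes-f) λ ()
    ... | inj₂ (inj₁ d↦g)              = contradiction (clash d↦g fixes-g) λ ()
    ... | inj₂ (inj₂ (inj₁ (j , d↦b))) = contradiction d↦b (D↛B i j)
    ... | inj₂ (inj₂ (inj₂ d↦D))       = d↦D

    preserves-A : (∀ j → InPart C (from (c j))) → ∀ i → InPart A (to (a i))
    preserves-A from-C i with Adj-f (preserve-at {v = a i} fixes-f (inj₁ tt))
    ... | inj₁ a↦e              = contradiction (clash a↦e fixes-e) λ ()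
    ... | inj₂ (inj₁ a↦A)       = a↦A
    ... | inj₂ (inj₂ (j , a↦c)) with from-C j
    ...   | _ , c↤c = contradiction (trans (sym (inverseʳ (sym a↦c))) c↤c) λ ()

    preserves-B : (∀ j → InPart D (from (d j))) → ∀ i → InPart B (to (b i))
    preserves-B from-D i with Adj-e (preserve-at {v = b i} fixes-e (inj₁ tt))
    ... | inj₁ b↦f                     = contradiction (clash b↦f fixes-f) λ ()
    ... | inj₂ (inj₁ b↦g)              = contradiction (clash b↦g fixes-g) λ ()
    ... | inj₂ (inj₂ (inj₁ b↦B))       = b↦B
    ... | inj₂ (inj₂ (inj₂ (j , b↦d))) with from-D j
    ...   | _ , d↤d = contradiction (trans (sym (inverseʳ (sym b↦d))) d↤d) λ ()

  Adj-iso-sym : ∀ {π₁ π₂ : Permutation′ n} (ψ : V ↔ V) → IsIso (Adj π₁) (Adj π₂) ψ →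
                IsIso (Adj π₂) (Adj π₁) (↔-sym ψ)
  Adj-iso-sym {π₁} {π₂} ψ = Isomorphism.IsIso-sym (Adj π₁) (Adj π₂) ψ

  preserves-part : ∀ {π₁ π₂ : Permutation′ n} (ψ : V ↔ V) → IsIso (Adj π₁) (Adj π₂) ψ →
                   ∀ x i → InPart x (Inverse.to ψ (old (x , i)))
  preserves-part ψ iso A =
    Rigidity.preserves-A ψ iso (Rigidity.preserves-C (↔-sym ψ) (Adj-iso-sym ψ iso))
  preserves-part ψ iso B =
    Rigidity.preserves-B ψ iso (Rigidity.preserves-D (↔-sym ψ) (Adj-iso-sym ψ iso))
  preserves-part ψ iso C = Rigidity.preserves-C ψ iso
  preserves-part ψ iso D = Rigidity.preserves-D ψ iso

  old-image : ∀ {π₁ π₂ : Permutation′ n} (ψ : V ↔ V) → IsIso (Adj π₁) (Adj π₂) ψ →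
              ∀ u → ∃ λ u′ → Inverse.to ψ (old u) ≡ old u′
  old-image ψ iso (x , i) = (x , proj₁ (preserves-part ψ iso x i)) , proj₂ (preserves-part ψ iso x i)

  clean-restriction : ∀ {π₁ π₂ : Permutation′ n} → Isomorphic (Adj π₁) (Adj π₂) →
                      Σ (V⁻ n ↔ V⁻ n) (λ φ → IsIso (Adj⁻ π₁) (Adj⁻ π₂) φ × IsClean (Inverse.to φ))
  clean-restriction {π₁} {π₂} (ψ , iso) =
    restriction , restriction-IsIso (Adj π₁) (Adj π₂) iso , λ _ _ → refl
    where
    open Restriction old-injective ψ (old-image ψ iso) (old-image (↔-sym ψ) (Adj-iso-sym ψ iso))

lemma16 : (n : ℕ) → n ≥ 3 → (π₁ π₂ : Permutation′ n) →
    Isomorphic (Adj {n} π₁) (Adj {n} π₂)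
      ⇔ Σ (V⁻ n ↔ V⁻ n) (λ φ → IsIso (Adj⁻ π₁) (Adj⁻ π₂) φ × IsClean (Inverse.to φ))
lemma16 _ (s≤s (s≤s (s≤s _))) π₁ π₂ =
  mk⇔ clean-restriction (λ (φ , iso , clean) → extension φ , extension-IsIso φ iso clean)
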